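{- Let $S$ and $T$ be $q$-ary purely alternating strings such that $S\Rightarrow_* T$, and let $AXA'\Rightarrow AXXA'$ be one of the duplications in a sequence of duplications leading from $S$ to $T$. Then $|RLE(X)|\bmod q\le 1$, where $|RLE(X)|$ is the number of runs of $X$.
   Context: A run of a string is a maximal substring consisting of copies of a single character. A string using exactly $q$ distinct characters is $q$-ary; it is purely alternating if there is a cyclic order $\sigma_0,\dots,\sigma_{q-1}$ of its characters such that each run of $\sigma_r$ is followed by a run of $\sigma_{(r+1)\bmod q}$. A tandem duplication turns $AXB$ into $AXXB$ ($X$ nonempty); $S\Rightarrow_* T$ means $T$ is obtained from $S$ by a finite sequence of tandem duplications. -}

module Defs where

open import Data.Nat using (ℕ; suc)
open import Data.Nat.DivMod using (_%_; m%n<n)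
open import Data.Fin using (Fin; toℕ; fromℕ<)
open import Data.List using (List; []; _∷_; _++_; map; length)
open import Data.List.Membership.Propositional using (_∈_)
open import Data.Product using (Σ; ∃; _×_; _,_; proj₁)
open import Data.Unit using (⊤)
open import Relation.Binary.PropositionalEquality using (_≡_; _≢_)
open import Relation.Binary.Definitions using (DecidableEquality)
open import Relation.Binary.Construct.Closure.ReflexiveTransitive using (Star)
open import Relation.Nullary using (yes; no)
open import Function.Definitions using (Injective)

next : ∀ {q} → Fin q → Fin q
next {suc n} r = fromℕ< (m%n<n (suc (toℕ r)) (suc n))

module _ {A : Set} where

  rle : DecidableEquality A → List A → List (A × ℕ)
  rle _≟_ [] = []
  rle _≟_ (c ∷ s) with rle _≟_ s
  ... | [] = (c , 1) ∷ []
  ... | (d , n) ∷ r with c ≟ d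
  ...   | yes _ = (d , suc n) ∷ r
  ...   | no _ = (c , 1) ∷ (d , n) ∷ r

  runs : DecidableEquality A → List A → ℕ
  runs _≟_ s = length (rle _≟_ s)

  Enumerates : ∀ {q} → (Fin q → A) → List A → Set
  Enumerates σ s = Injective _≡_ _≡_ σ
                 × (∀ c → c ∈ s → ∃ λ r → σ r ≡ c)
                 × (∀ r → σ r ∈ s)

  IsQAry : ℕ → List A → Set
  IsQAry q s = Σ (Fin q → A) λ σ → Enumerates σ s

  FollowsCycle : ∀ {q} → (Fin q → A) → List A → Set
  FollowsCycle σ [] = ⊤
  FollowsCycle σ (c ∷ []) = ⊤
  FollowsCycle σ (c ∷ d ∷ rest) =
    (∀ r → σ r ≡ c → σ (next r) ≡ d) × FollowsCycle σ (d ∷ rest)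

  PurelyAlternating : DecidableEquality A → ℕ → List A → Set
  PurelyAlternating _≟_ q s =
    Σ (Fin q → A) λ σ → Enumerates σ s × FollowsCycle σ (map proj₁ (rle _≟_ s))

  data Dup : List A → List A → Set where
    dup : (a x b : List A) → x ≢ [] → Dup (a ++ x ++ b) (a ++ x ++ x ++ b)

  _⇒*_ : List A → List A → Set
  _⇒*_ = Star Dup

-- The duplication A X A′ ⇒ A X X A′ creates the square X X, and the
-- adjacencies of X X are still visible in the purely alternating target T.
--
-- * Adjacencies persist: if c is immediately followed by d somewhere in a
--   string, this stays true after any tandem duplication, hence in T.
-- * In a purely alternating T with cyclic order σ, every adjacency c d with
--   c ≢ d is a step of the cycle: d is the σ-successor of c.
-- * So every change of character in X X is a cycle step.  Walking through X,
--   which changes character (runs X - 1) times, the last character of X sits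
--   (runs X - 1) steps after the first one; the adjacency "last X, first X"
--   in X X closes the loop with 0 further steps (equal characters) or 1.
--   Since σ is injective, returning to the start after m steps forces q ∣ m,
--   so runs X ≡ 1 or runs X ≡ 0 modulo q.
module Submission where

open import Defs
open import Data.Nat using (ℕ; zero; suc; _+_; _∸_; _≤_; _<_; z≤n; NonZero)
open import Data.Nat.Properties using (+-comm; +-assoc; +-suc; +-identityʳ; m∸n+n≡m; <⇒≤)
open import Data.Nat.DivMod using (_%_; %-distribˡ-+; %-congˡ; m%n%n≡m%n; [m+n]%n≡m%n; n%n≡0; m<n⇒m%n≡m; m%n<n; m%n≤m)
open import Data.Fin using (Fin; toℕ)
open import Data.Fin.Properties using (toℕ-fromℕ<; toℕ<n)
open import Data.List using (List; []; _∷_; _++_; map; length)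
open import Data.List.Properties using (++-assoc; length-map)
open import Data.List.Membership.Propositional using (_∈_)
import Data.List.Relation.Unary.Any as Any
open import Data.Product using (∃; _×_; _,_; proj₁; proj₂)
open import Data.Sum as Sum using (_⊎_; inj₁; inj₂)
open import Data.Empty using (⊥-elim)
open import Function.Definitions using (Injective)
open import Relation.Binary.PropositionalEquality
open import Relation.Binary.Definitions using (DecidableEquality)
open import Relation.Binary.Construct.Closure.ReflexiveTransitive using (ε; _◅_)
open import Relation.Nullary using (Dec; yes; no)

%-absorbʳ : ∀ m n d .{{_ : NonZero d}} → (m + n % d) % d ≡ (m + n) % d
%-absorbʳ m n d = begin
  (m + n % d) % d          ≡⟨ %-distribˡ-+ m (n % d) d ⟩
  (m % d + n % d % d) % d  ≡⟨ cong (λ k → (m % d + k) % d) (m%n%n≡m%n n d) ⟩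
  (m % d + n % d) % d      ≡⟨ %-distribˡ-+ m n d ⟨
  (m + n) % d              ∎
  where open ≡-Reasoning

%-fixed⇒divisible : ∀ {a d} m .{{_ : NonZero d}} → a < d → (a + m) % d ≡ a → m % d ≡ 0
%-fixed⇒divisible {a} {d} m a<d fixed = begin
  m % d                  ≡⟨ [m+n]%n≡m%n m d ⟨
  (m + d) % d            ≡⟨ %-congˡ reorder ⟩
  (d ∸ a + (a + m)) % d  ≡⟨ %-absorbʳ (d ∸ a) (a + m) d ⟨
  (d ∸ a + (a + m) % d) % d ≡⟨ cong (λ k → (d ∸ a + k) % d) fixed ⟩
  (d ∸ a + a) % d        ≡⟨ %-congˡ (m∸n+n≡m (<⇒≤ a<d)) ⟩
  d % d                  ≡⟨ n%n≡0 d ⟩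
  0                      ∎
  where
  open ≡-Reasoning
  reorder : m + d ≡ d ∸ a + (a + m)
  reorder = begin
    m + d            ≡⟨ +-comm m d ⟩
    d + m            ≡⟨ cong (_+ m) (m∸n+n≡m (<⇒≤ a<d)) ⟨
    d ∸ a + a + m    ≡⟨ +-assoc (d ∸ a) a m ⟩
    d ∸ a + (a + m)  ∎

next^ : ∀ {q} → ℕ → Fin q → Fin q
next^ zero r = r
next^ (suc m) r = next (next^ m r)

next^-next : ∀ {q} m (r : Fin q) → next^ m (next r) ≡ next (next^ m r)
next^-next zero r = refl
next^-next (suc m) r = cong next (next^-next m r)

toℕ-next^ : ∀ {n} m (r : Fin (suc n)) → toℕ (next^ m r) ≡ (toℕ r + m) % suc n
toℕ-next^ {n} zero r = sym (begin
  (toℕ r + 0) % suc n  ≡⟨ %-congˡ (+-identityʳ (toℕ r)) ⟩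
  toℕ r % suc n        ≡⟨ m<n⇒m%n≡m (toℕ<n r) ⟩
  toℕ r                ∎)
  where open ≡-Reasoning
toℕ-next^ {n} (suc m) r = begin
  toℕ (next (next^ m r))            ≡⟨ toℕ-fromℕ< (m%n<n (suc (toℕ (next^ m r))) (suc n)) ⟩
  (1 + toℕ (next^ m r)) % suc n     ≡⟨ cong (λ k → (1 + k) % suc n) (toℕ-next^ m r) ⟩
  (1 + (toℕ r + m) % suc n) % suc n ≡⟨ %-absorbʳ 1 (toℕ r + m) (suc n) ⟩
  (1 + (toℕ r + m)) % suc n         ≡⟨ %-congˡ (+-suc (toℕ r) m) ⟨
  (toℕ r + suc m) % suc n           ∎
  where open ≡-Reasoning

next^-return : ∀ {n} m (r : Fin (suc n)) → next^ m r ≡ r → m % suc n ≡ 0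
next^-return m r back = %-fixed⇒divisible m (toℕ<n r) (trans (sym (toℕ-next^ m r)) (cong toℕ back))

module _ {A : Set} where

  data Adj (c d : A) : List A → Set where
    here  : ∀ {s} → Adj c d (c ∷ d ∷ s)
    there : ∀ {x s} → Adj c d s → Adj c d (x ∷ s)

  adj-∈ : ∀ {c d s} → Adj c d s → d ∈ s
  adj-∈ here = Any.there (Any.here refl)
  adj-∈ (there p) = Any.there (adj-∈ p)

  adj-++ˡ : ∀ {c d u} v → Adj c d u → Adj c d (u ++ v)
  adj-++ˡ v here = here
  adj-++ˡ v (there p) = there (adj-++ˡ v p)

  adj-++ʳ : ∀ {c d} u {v} → Adj c d v → Adj c d (u ++ v)
  adj-++ʳ [] p = p
  adj-++ʳ (x ∷ u) p = there (adj-++ʳ u p)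

  lastOf : A → List A → A
  lastOf c [] = c
  lastOf c (e ∷ s) = lastOf e s

  adj-wrap : ∀ c s d w → Adj (lastOf c s) d (c ∷ s ++ d ∷ w)
  adj-wrap c [] d w = here
  adj-wrap c (e ∷ s) d w = there (adj-wrap e s d w)

  adj-split : ∀ {c d} a x b → x ≢ [] → Adj c d (a ++ x ++ b) → Adj c d (a ++ x) ⊎ Adj c d (x ++ b)
  adj-split [] x b _ p = inj₂ p
  adj-split (y ∷ a) [] b x≢[] p = ⊥-elim (x≢[] refl)
  adj-split (y ∷ []) (z ∷ x) b _ here = inj₁ here
  adj-split (y ∷ z ∷ a) (w ∷ x) b _ here = inj₁ here
  adj-split (y ∷ a) (z ∷ x) b x≢[] (there p) = Sum.map₁ there (adj-split a (z ∷ x) b x≢[] p)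

  -- Adjacencies survive a tandem duplication, since a x and x b both occur in a x x b ...
  adj-dup : ∀ {c d s t} → Dup s t → Adj c d s → Adj c d t
  adj-dup {c} {d} (dup a x b x≢[]) p with adj-split a x b x≢[] p
  ... | inj₁ p₁ = subst (Adj c d) (++-assoc a x (x ++ b)) (adj-++ˡ (x ++ b) p₁)
  ... | inj₂ p₂ = adj-++ʳ a (adj-++ʳ x p₂)

  adj-⇒* : ∀ {c d s t} → s ⇒* t → Adj c d s → Adj c d t
  adj-⇒* ε p = p
  adj-⇒* (step ◅ steps) p = adj-⇒* steps (adj-dup step p)

  Step : ∀ {q} → (Fin q → A) → A → A → Set
  Step σ c d = ∀ r → σ r ≡ c → σ (next r) ≡ d

  ChangesFollow : ∀ {q} → (Fin q → A) → List A → Set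
  ChangesFollow σ s = ∀ {c d} → Adj c d s → c ≢ d → Step σ c d

  module Runs (_≟_ : DecidableEquality A) where

    heads : List A → List A
    heads s = map proj₁ (rle _≟_ s)

    changes : A → List A → ℕ
    changes c [] = 0
    changes c (d ∷ s) with c ≟ d
    ... | yes _ = changes d s
    ... | no _ = suc (changes d s)

    rle-cons : ∀ d s → ∃ λ n → ∃ λ r → rle _≟_ (d ∷ s) ≡ (d , n) ∷ r
    rle-cons d s with rle _≟_ s
    ... | [] = 1 , [] , refl
    ... | (e , n) ∷ r with d ≟ e
    ...   | yes refl = suc n , r , refl
    ...   | no _ = 1 , (e , n) ∷ r , refl

    heads-cons : ∀ d s → ∃ λ t → heads (d ∷ s) ≡ d ∷ t
    heads-cons d s with rle-cons d s
    ... | n , r , eq = map proj₁ r , cong (map proj₁) eq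

    heads-same : ∀ d s → heads (d ∷ d ∷ s) ≡ heads (d ∷ s)
    heads-same d s with rle-cons d s
    ... | n , r , eq rewrite eq with d ≟ d
    ...   | yes refl = refl
    ...   | no d≢d = ⊥-elim (d≢d refl)

    heads-change : ∀ c d s → c ≢ d → heads (c ∷ d ∷ s) ≡ c ∷ heads (d ∷ s)
    heads-change c d s c≢d with rle-cons d s
    ... | n , r , eq rewrite eq with c ≟ d
    ...   | yes c≡d = ⊥-elim (c≢d c≡d)
    ...   | no _ = refl

    runs-changes : ∀ c s → runs _≟_ (c ∷ s) ≡ suc (changes c s)
    runs-changes c s = trans (sym (length-map proj₁ (rle _≟_ (c ∷ s)))) (length-heads c s)
      where
      length-heads : ∀ c s → length (heads (c ∷ s)) ≡ suc (changes c s)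
      length-heads c [] = refl
      length-heads c (d ∷ s) with c ≟ d
      ... | yes refl = trans (cong length (heads-same c s)) (length-heads c s)
      ... | no c≢d = trans (cong length (heads-change c d s c≢d)) (cong suc (length-heads d s))

    followsCycle-uncons : ∀ {q} (σ : Fin q → A) c d s → FollowsCycle σ (heads (c ∷ d ∷ s)) →
                          (c ≢ d → Step σ c d) × FollowsCycle σ (heads (d ∷ s))
    followsCycle-uncons σ c d s fc with c ≟ d
    ... | yes refl = (λ c≢c → ⊥-elim (c≢c refl)) , subst (FollowsCycle σ) (heads-same c s) fc
    ... | no c≢d with heads-cons d s
    ...   | t , eq = (λ _ → proj₁ fc′) , subst (FollowsCycle σ) (sym eq) (proj₂ fc′)
      where
      fc′ : FollowsCycle σ (c ∷ d ∷ t)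
      fc′ = subst (FollowsCycle σ) (trans (heads-change c d s c≢d) (cong (c ∷_) eq)) fc

    followsCycle⇒changesFollow : ∀ {q} (σ : Fin q → A) s → FollowsCycle σ (heads s) → ChangesFollow σ s
    followsCycle⇒changesFollow σ (c ∷ d ∷ s) fc here = proj₁ (followsCycle-uncons σ c d s fc)
    followsCycle⇒changesFollow σ (c ∷ d ∷ s) fc (there p) =
      followsCycle⇒changesFollow σ (d ∷ s) (proj₂ (followsCycle-uncons σ c d s fc)) p

    walk : ∀ {q} (σ : Fin q → A) c s {r} → ChangesFollow σ (c ∷ s) → σ r ≡ c →
           σ (next^ (changes c s) r) ≡ lastOf c s
    walk σ c [] cf σr≡c = σr≡c
    walk σ c (d ∷ s) {r} cf σr≡c with c ≟ d
    ... | yes refl = walk σ c s (λ p → cf (there p)) σr≡c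
    ... | no c≢d = subst (λ i → σ i ≡ lastOf d s) (next^-next (changes d s) r)
                     (walk σ d s (λ p → cf (there p)) (cf here c≢d r σr≡c))

    runsModCycle : ∀ {n} (σ : Fin (suc n) → A) c s → Injective _≡_ _≡_ σ →
                   ChangesFollow σ ((c ∷ s) ++ (c ∷ s)) → (∃ λ r → σ r ≡ c) →
                   runs _≟_ (c ∷ s) % suc n ≤ 1
    runsModCycle {n} σ c s σ-inj cf (r , σr≡c) =
      subst (λ m → m % suc n ≤ 1) (sym (runs-changes c s)) (closeLoop (lastOf c s ≟ c))
      where
      k = changes c s
      arrive : σ (next^ k r) ≡ lastOf c s
      arrive = walk σ c s (λ p → cf (adj-++ˡ (c ∷ s) p)) σr≡c
      -- the adjacency "last of X, first of X" in X X closes the loop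
      closeLoop : Dec (lastOf c s ≡ c) → suc k % suc n ≤ 1
      closeLoop (yes last≡c) = subst (_≤ 1) (sym oneMod) (m%n≤m 1 (suc n))
        where
        divides : k % suc n ≡ 0
        divides = next^-return k r (σ-inj (trans arrive (trans last≡c (sym σr≡c))))
        oneMod : suc k % suc n ≡ 1 % suc n
        oneMod = trans (sym (%-absorbʳ 1 k (suc n))) (cong (λ m → (1 + m) % suc n) divides)
      closeLoop (no last≢c) = subst (_≤ 1) (sym divides) z≤n
        where
        divides : suc k % suc n ≡ 0
        divides = next^-return (suc k) r
                    (σ-inj (trans (cf (adj-wrap c s c s) last≢c (next^ k r) arrive) (sym σr≡c)))

claim2 : {Ch : Set} (_≟_ : DecidableEquality Ch) (q : ℕ) .{{_ : NonZero q}}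
         (S T A X A′ : List Ch) →
         IsQAry q S → PurelyAlternating _≟_ q S →
         IsQAry q T → PurelyAlternating _≟_ q T →
         X ≢ [] →
         S ⇒* (A ++ X ++ A′) →
         (A ++ X ++ X ++ A′) ⇒* T →
         runs _≟_ X % q ≤ 1
claim2 _≟_ (suc n) S T A [] A′ _ _ _ _ X≢[] _ _ = ⊥-elim (X≢[] refl)
claim2 _≟_ (suc n) S T A (c ∷ s) A′ _ _ _ (σ , (σ-inj , σ-covers , _) , σ-cycle) _ _ toT =
  runsModCycle σ c s σ-inj changesXX (σ-covers c (adj-∈ (inT (adj-wrap c s c s))))
  where
  open Runs _≟_
  X = c ∷ s
  inT : ∀ {a b} → Adj a b (X ++ X) → Adj a b T
  inT p = adj-⇒* toT (adj-++ʳ A (subst (Adj _ _) (++-assoc X X A′) (adj-++ˡ A′ p)))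
  changesXX : ChangesFollow σ (X ++ X)
  changesXX p = followsCycle⇒changesFollow σ T σ-cycle (inT p)
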